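{- Let $r\in \mathbb{N}$ with $r\ge 4$ and let $\tau,\mu$ be constants with $0<\tau<\mu$. Then there exist constants $\alpha,\beta_1,\gamma_1>0$ such that the following holds for all sufficiently large $n$. Let $G$ be an $n$-vertex graph with $\delta(G)\geq \left(\frac{1}{2}+\mu\right)n$ and $\alpha_{r-2}(G)\leq \alpha n$. Then $G$ admits a vertex partition $V(G)=B\cup U$ such that $|B|\leq \tau n$ and every vertex in $U$ is $(K_{r}, \beta_{1}n, 1)$-inner-reachable (within $U$) to at least $\gamma_{1}n$ other vertices of $U$.
   Context: For a graph $G$ and an integer $\ell\ge 2$, $\alpha_{\ell}(G)$ is the maximum size of a set $S\subseteq V(G)$ such that $G[S]$ contains no copy of $K_\ell$. A $K_r$-factor of a graph is a collection of vertex-disjoint copies of $K_r$ covering all its vertices. For $m,t\in\mathbb{N}$, two vertices $u,v$ of $G$ are $(K_r,m,t)$-reachable if for every set $W\subseteq V(G)$ of $m$ vertices there is a set $S\subseteq V(G)\setminus W$ with $|S|\le rt-1$ such that both $G[S\cup\{u\}]$ and $G[S\cup\{v\}]$ have $K_r$-factors. For $U\subseteq V(G)$ and $u,v\in U$, $u,v$ are $(K_r,m,t)$-inner-reachable (within $U$) if moreover such a set $S$ can always be chosen inside $U$, i.e. $S\subseteq U\setminus W$.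
   Formalization: The constants τ and μ range over the rationals. -}

module Defs where

open import Data.Nat using (ℕ; suc; _∸_) renaming (_*_ to _*ℕ_)
open import Data.Integer using (+_)
open import Data.Rational using (ℚ; _/_; _≤_; _*_)
open import Data.Fin using (Fin)
open import Data.Fin.Subset using (Subset; _∈_; _∉_; _⊆_; ∣_∣; ⁅_⁆; _∪_)
open import Data.Bool using (Bool; true; false)
open import Data.List using (List)
open import Data.List.Relation.Unary.All using (All)
open import Data.List.Relation.Unary.Any using (Any)
open import Data.List.Relation.Unary.AllPairs using (AllPairs)
open import Data.Product using (Σ; _×_; ∃)
open import Relation.Binary.PropositionalEquality using (_≡_)
open import Relation.Nullary using (¬_)

ℕ→ℚ : ℕ → ℚ
ℕ→ℚ n = + n / 1

record Graph (n : ℕ) : Set where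
  field
    adj    : Fin n → Fin n → Bool
    sym    : ∀ x y → adj x y ≡ adj y x
    irrefl : ∀ x → adj x x ≡ false
open Graph public

N : ∀ {n} → Graph n → Fin n → Subset n
N {n} G v = Data.Vec.tabulate (λ w → Data.Bool.if adj G v w then Data.Fin.Subset.inside else Data.Fin.Subset.outside)
  where import Data.Vec ; import Data.Bool ; import Data.Fin.Subset

deg : ∀ {n} → Graph n → Fin n → ℕ
deg G v = ∣ N G v ∣

MinDegAtLeast : ∀ {n} → Graph n → ℚ → Set
MinDegAtLeast {n} G c = ∀ v → c * ℕ→ℚ n ≤ ℕ→ℚ (deg G v)

IsClique : ∀ {n} → Graph n → Subset n → Set
IsClique G T = ∀ x y → x ∈ T → y ∈ T → ¬ (x ≡ y) → adj G x y ≡ true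

ContainsK : ∀ {n} → Graph n → ℕ → Subset n → Set
ContainsK G ℓ S = Σ _ λ T → T ⊆ S × ∣ T ∣ ≡ ℓ × IsClique G T

-- α_ℓ(G) ≤ c·n : every K_ℓ-free induced subgraph has at most c·n vertices
-- (the maximum of such sizes is at most c·n)
AlphaAtMost : ∀ {n} → Graph n → ℕ → ℚ → Set
AlphaAtMost {n} G ℓ c = ∀ S → ¬ ContainsK G ℓ S → ℕ→ℚ ∣ S ∣ ≤ c * ℕ→ℚ n

HasKFactor : ∀ {n} → Graph n → ℕ → Subset n → Set
HasKFactor {n} G r X =
  Σ (List (Subset n)) λ Ts →
    All (λ T → T ⊆ X × ∣ T ∣ ≡ r × IsClique G T) Ts
    × AllPairs (λ T T′ → ∀ x → x ∈ T → x ∉ T′) Ts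
    × (∀ x → x ∈ X → Any (λ T → x ∈ T) Ts)

-- u,v are (K_r, m, t)-inner-reachable within U, with m = c·n (W ranges over
-- all vertex sets of size at most c·n)
InnerReachable : ∀ {n} → Graph n → ℕ → ℚ → ℕ → Subset n → Fin n → Fin n → Set
InnerReachable {n} G r c t U u v =
  ∀ (W : Subset n) → ℕ→ℚ ∣ W ∣ ≤ c * ℕ→ℚ n →
    Σ (Subset n) λ S →
      S ⊆ U × (∀ x → x ∈ S → x ∉ W) × ∣ S ∣ Data.Nat.≤ (r *ℕ t) ∸ 1
      × HasKFactor G r (S ∪ ⁅ u ⁆) × HasKFactor G r (S ∪ ⁅ v ⁆)
  where import Data.Nat

{-# OPTIONS --safe #-}
module Submission where

open import Defs renaming (sym to adj-sym; irrefl to adj-irrefl)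

-- Take B = ∅ and U = V(G). Write the degree condition as δ(G) ≥ (k + 1) n / 2k; then any two
-- vertices have at least n / k common neighbours. Fix u and let F(v) count the ordered edges inside
-- N(u) ∩ N(v). Summing over v counts every triangle u z w with weight codeg(z, w) ≥ n / k, so
-- Σ_v F(v) ≥ n³ / 2k², while F(v) ≤ n²; hence for n ≥ 16k² at least n / 4k² vertices v ≠ u have
-- F(v) > 3n² / 16k². Given such a v and W with |W| ≤ n / 16k², if no z ∈ N(u) ∩ N(v) ∖ W had more
-- than n / 16k² neighbours in N(u) ∩ N(v) ∖ W, then F(v) ≤ 3n² / 16k². So some z does, and
-- α_{r-2}(G) ≤ n / 16k² puts a K_{r-2} among those neighbours; with z it is a K_{r-1} avoiding W
-- whose union with u, and with v, is a K_r. Hence α = β₁ = 1 / 16k², γ₁ = 1 / 4k², n₀ = 16k².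

module Combinatorics where

  open import Data.Bool as Bool using (Bool; true; false; _∧_; not; T; if_then_else_)
  open import Data.Bool.Properties using (∧-conicalˡ; ∧-conicalʳ)
  open import Data.Fin as Fin using (Fin; zero; suc)
  open import Data.Fin.Properties using (any?; all?)
  open import Data.Fin.Subset using (Subset; _∈_; _∉_; _⊆_; ∣_∣; ⁅_⁆; _∪_; _-_; ⊤; inside; outside)
  open import Data.Fin.Subset.Properties
    using (p─⊥≡p; ∪-identityʳ; x∈p∪q⁻; x∈⁅y⁆⇒x≡y; ∈⊤; _∈?_; _⊆?_; anySubset?)
  open import Data.List using ([]; _∷_)
  open import Data.List.Relation.Unary.All using ([]; _∷_)
  open import Data.List.Relation.Unary.AllPairs using ([]; _∷_)
  import Data.List.Relation.Unary.Any as Any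
  open import Data.Nat as ℕ using (ℕ; zero; suc; _+_; _*_; _∸_; _≤_; _<_; z≤n; s≤s; NonZero; _<ᵇ_)
  open import Data.Nat.Properties as ℕ
    using (≤-refl; ≤-trans; ≤-reflexive; +-mono-≤; *-monoʳ-≤; m≤m+n; m≤n+m; <ᵇ⇒<; <⇒<ᵇ; ≮⇒≥; <⇒≱; _<?_
          ; module ≤-Reasoning)
  open import Data.Nat.Tactic.RingSolver using (solve-∀)
  open import Algebra.Properties.Semiring.Sum ℕ.+-*-semiring
    using (sum; sum-cong-≗; ∑-distrib-+; ∑-comm; *-distribˡ-sum)
  open import Data.Product using (Σ; _×_; _,_; proj₁; proj₂; ∃)
  open import Data.Sum using (inj₁; inj₂)
  open import Data.Vec using (_∷_; here; there; tabulate; lookup)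
  open import Data.Vec.Properties using (lookup∘tabulate; []=⇒lookup; tabulate∘lookup)
  open import Function using (_∘_)
  open import Relation.Binary.PropositionalEquality
  open import Relation.Nullary using (Dec; ¬_; ¬?; contradiction)
  open import Relation.Nullary.Decidable using (_×-dec_; _→-dec_; decidable-stable)

  sum-mono-≤ : ∀ {n} {f g : Fin n → ℕ} → (∀ i → f i ≤ g i) → sum f ≤ sum g
  sum-mono-≤ {zero}  f≤g = z≤n
  sum-mono-≤ {suc n} f≤g = +-mono-≤ (f≤g zero) (sum-mono-≤ (f≤g ∘ suc))

  sum-const : ∀ n c → sum {n} (λ _ → c) ≡ n * c
  sum-const zero    c = refl
  sum-const (suc n) c = cong (c +_) (sum-const n c)

  sum≤n : ∀ {n} {f : Fin n → ℕ} → (∀ i → f i ≤ 1) → sum f ≤ n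
  sum≤n {n} f≤1 = ≤-trans (sum-mono-≤ f≤1) (≤-reflexive (trans (sum-const n 1) (ℕ.*-identityʳ n)))

  sum-weighted-≥ : ∀ {n} m k (a c : Fin n → ℕ) → (∀ i → m ≤ k * c i) →
                   m * sum a ≤ k * sum (λ i → a i * c i)
  sum-weighted-≥ m k a c m≤kc = begin
    m * sum a                    ≡⟨ *-distribˡ-sum m a ⟩
    sum (λ i → m * a i)          ≤⟨ sum-mono-≤ (λ i → ≤-trans (≤-reflexive (ℕ.*-comm m (a i))) (*-monoʳ-≤ (a i) (m≤kc i))) ⟩
    sum (λ i → a i * (k * c i))  ≡⟨ sum-cong-≗ (λ i → swap-middle (a i) k (c i)) ⟩
    sum (λ i → k * (a i * c i))  ≡⟨ *-distribˡ-sum k (λ i → a i * c i) ⟨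
    k * sum (λ i → a i * c i)    ∎
    where
    open ≤-Reasoning
    swap-middle : ∀ x y z → x * (y * z) ≡ y * (x * z)
    swap-middle = solve-∀

  𝟙 : Bool → ℕ
  𝟙 true  = 1
  𝟙 false = 0

  𝟙≤1 : ∀ b → 𝟙 b ≤ 1
  𝟙≤1 true  = ≤-refl
  𝟙≤1 false = z≤n

  𝟙*𝟙*≤ : ∀ a b x → 𝟙 a * 𝟙 b * x ≤ x
  𝟙*𝟙*≤ true  true  x = ≤-reflexive (ℕ.+-identityʳ x)
  𝟙*𝟙*≤ true  false x = z≤n
  𝟙*𝟙*≤ false b     x = z≤n

  𝟙*𝟙*𝟙≤1 : ∀ a b c → 𝟙 a * 𝟙 b * 𝟙 c ≤ 1
  𝟙*𝟙*𝟙≤1 a b c = ≤-trans (𝟙*𝟙*≤ a b (𝟙 c)) (𝟙≤1 c)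

  𝟙+𝟙≤1+𝟙*𝟙 : ∀ a b → 𝟙 a + 𝟙 b ≤ 1 + 𝟙 a * 𝟙 b
  𝟙+𝟙≤1+𝟙*𝟙 true  true  = ≤-refl
  𝟙+𝟙≤1+𝟙*𝟙 true  false = ≤-refl
  𝟙+𝟙≤1+𝟙*𝟙 false b     = 𝟙≤1 b

  ∣tabulate∣≡∑𝟙 : ∀ {n} (f : Fin n → Bool) → ∣ tabulate f ∣ ≡ sum (𝟙 ∘ f)
  ∣tabulate∣≡∑𝟙 {zero}  f = refl
  ∣tabulate∣≡∑𝟙 {suc n} f with f zero
  ... | true  = cong suc (∣tabulate∣≡∑𝟙 (f ∘ suc))
  ... | false = ∣tabulate∣≡∑𝟙 (f ∘ suc)

  ∣p∣≡∑𝟙 : ∀ {n} (p : Subset n) → ∣ p ∣ ≡ sum (𝟙 ∘ lookup p)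
  ∣p∣≡∑𝟙 p = trans (cong ∣_∣ (sym (tabulate∘lookup p))) (∣tabulate∣≡∑𝟙 (lookup p))

  ∈-tabulate⁻ : ∀ {n} {f : Fin n → Bool} {x} → x ∈ tabulate f → f x ≡ true
  ∈-tabulate⁻ {f = f} {x} x∈ = trans (sym (lookup∘tabulate f x)) ([]=⇒lookup x∈)

  above : ∀ {n} → ℕ → (Fin n → ℕ) → Subset n
  above t f = tabulate (λ i → t <ᵇ f i)

  ∈-above⁻ : ∀ {n t} {f : Fin n → ℕ} {i} → i ∈ above t f → t < f i
  ∈-above⁻ {t = t} {f} {i} i∈ = <ᵇ⇒< t (f i) (subst T (sym (∈-tabulate⁻ i∈)) _)

  sum≤bound*∣above∣+n*t : ∀ {n} (f : Fin n → ℕ) b t → (∀ i → f i ≤ b) →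
                          sum f ≤ b * ∣ above t f ∣ + n * t
  sum≤bound*∣above∣+n*t {n} f b t f≤b = begin
    sum f                                      ≤⟨ sum-mono-≤ split ⟩
    sum (λ i → b * 𝟙 (t <ᵇ f i) + t)           ≡⟨ ∑-distrib-+ (λ i → b * 𝟙 (t <ᵇ f i)) (λ _ → t) ⟩
    sum (λ i → b * 𝟙 (t <ᵇ f i)) + sum {n} (λ _ → t)
      ≡⟨ cong₂ _+_ (sym (*-distribˡ-sum b (λ i → 𝟙 (t <ᵇ f i)))) (sum-const n t) ⟩
    b * sum (λ i → 𝟙 (t <ᵇ f i)) + n * t       ≡⟨ cong (λ m → b * m + n * t) (sym (∣tabulate∣≡∑𝟙 (λ i → t <ᵇ f i))) ⟩
    b * ∣ above t f ∣ + n * t                  ∎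
    where
    open ≤-Reasoning
    split : ∀ i → f i ≤ b * 𝟙 (t <ᵇ f i) + t
    split i with t <ᵇ f i in eq
    ... | true  = ≤-trans (≤-trans (f≤b i) (≤-reflexive (sym (ℕ.*-identityʳ b)))) (m≤m+n _ t)
    ... | false = ≤-trans (≮⇒≥ (λ t<fi → subst T eq (<⇒<ᵇ t<fi))) (m≤n+m t _)

  x∉p-x : ∀ {n} (p : Subset n) x → x ∉ p - x
  x∉p-x (_ ∷ p) zero    ()
  x∉p-x (_ ∷ p) (suc x) (there x∈) = x∉p-x p x x∈

  ∣p∣≤1+∣p-x∣ : ∀ {n} (p : Subset n) x → ∣ p ∣ ≤ suc ∣ p - x ∣
  ∣p∣≤1+∣p-x∣ (true  ∷ p) zero    = s≤s (≤-reflexive (cong ∣_∣ (sym (p─⊥≡p p))))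
  ∣p∣≤1+∣p-x∣ (false ∷ p) zero    = ℕ.m≤n⇒m≤1+n (≤-reflexive (cong ∣_∣ (sym (p─⊥≡p p))))
  ∣p∣≤1+∣p-x∣ (true  ∷ p) (suc x) = s≤s (∣p∣≤1+∣p-x∣ p x)
  ∣p∣≤1+∣p-x∣ (false ∷ p) (suc x) = ∣p∣≤1+∣p-x∣ p x

  x∉p⇒∣p∪⁅x⁆∣≡1+∣p∣ : ∀ {n} (p : Subset n) x → x ∉ p → ∣ p ∪ ⁅ x ⁆ ∣ ≡ suc ∣ p ∣
  x∉p⇒∣p∪⁅x⁆∣≡1+∣p∣ (true  ∷ p) zero    x∉p = contradiction here x∉p
  x∉p⇒∣p∪⁅x⁆∣≡1+∣p∣ (false ∷ p) zero    _   = cong (suc ∘ ∣_∣) (∪-identityʳ p)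
  x∉p⇒∣p∪⁅x⁆∣≡1+∣p∣ (true  ∷ p) (suc x) x∉p = cong suc (x∉p⇒∣p∪⁅x⁆∣≡1+∣p∣ p x (x∉p ∘ there))
  x∉p⇒∣p∪⁅x⁆∣≡1+∣p∣ (false ∷ p) (suc x) x∉p = x∉p⇒∣p∪⁅x⁆∣≡1+∣p∣ p x (x∉p ∘ there)

  not-lookup⇒∉ : ∀ {n} {p : Subset n} {x} → not (lookup p x) ≡ true → x ∉ p
  not-lookup⇒∉ not-p[x] x∈p with trans (sym not-p[x]) (cong not ([]=⇒lookup x∈p))
  ... | ()

  module _ {n} (G : Graph n) where

    e : Fin n → Fin n → ℕ
    e x y = 𝟙 (adj G x y)

    e-sym : ∀ x y → e x y ≡ e y x
    e-sym x y = cong 𝟙 (adj-sym G x y)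

    deg≡∑e : ∀ v → deg G v ≡ sum (e v)
    deg≡∑e v = trans (∣tabulate∣≡∑𝟙 (λ w → if adj G v w then inside else outside))
      (sum-cong-≗ (λ w → 𝟙-if (adj G v w)))
      where
      𝟙-if : ∀ b → 𝟙 (if b then inside else outside) ≡ 𝟙 b
      𝟙-if true  = refl
      𝟙-if false = refl

    codeg : Fin n → Fin n → ℕ
    codeg x y = sum (λ w → e x w * e y w)

    deg+deg≤n+codeg : ∀ x y → deg G x + deg G y ≤ n + codeg x y
    deg+deg≤n+codeg x y = begin
      deg G x + deg G y              ≡⟨ cong₂ _+_ (deg≡∑e x) (deg≡∑e y) ⟩
      sum (e x) + sum (e y)          ≡⟨ ∑-distrib-+ (e x) (e y) ⟨
      sum (λ w → e x w + e y w)      ≤⟨ sum-mono-≤ (λ w → 𝟙+𝟙≤1+𝟙*𝟙 (adj G x w) (adj G y w)) ⟩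
      sum (λ w → 1 + e x w * e y w)  ≡⟨ ∑-distrib-+ (λ _ → 1) (λ w → e x w * e y w) ⟩
      sum {n} (λ _ → 1) + codeg x y  ≡⟨ cong (_+ codeg x y) (trans (sum-const n 1) (ℕ.*-identityʳ n)) ⟩
      n + codeg x y                  ∎
      where open ≤-Reasoning

    codeg₃ : Fin n → Fin n → Fin n → ℕ
    codeg₃ x y z = sum (λ w → e x w * e y w * e z w)

    codeg₃≤n : ∀ x y z → codeg₃ x y z ≤ n
    codeg₃≤n x y z = sum≤n (λ w → 𝟙*𝟙*𝟙≤1 (adj G x w) (adj G y w) (adj G z w))

    -- ordered pairs of adjacent vertices in the common neighbourhood of u and v
    edges∩ : Fin n → Fin n → ℕ
    edges∩ u v = sum (λ z → e u z * e v z * codeg₃ z u v)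

    edges∩≤n*n : ∀ u v → edges∩ u v ≤ n * n
    edges∩≤n*n u v = ≤-trans
      (sum-mono-≤ (λ z → ≤-trans (𝟙*𝟙*≤ (adj G u z) (adj G v z) _) (codeg₃≤n z u v)))
      (≤-reflexive (sum-const n n))

    𝟙△ : Fin n → Fin n → Fin n → ℕ
    𝟙△ x y z = e x y * e y z * e x z

    ∑edges∩≡ : ∀ u → sum (edges∩ u) ≡ sum (λ z → sum (λ w → 𝟙△ u z w * codeg z w))
    ∑edges∩≡ u = begin
      sum (λ v → sum (λ z → e u z * e v z * codeg₃ z u v))
        ≡⟨ sum-cong-≗ (λ v → sum-cong-≗ (λ z → expand v z)) ⟩
      sum (λ v → sum (λ z → sum (λ w → 𝟙△ u z w * (e z v * e w v))))
        ≡⟨ ∑-comm (λ v z → sum (λ w → 𝟙△ u z w * (e z v * e w v))) ⟩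
      sum (λ z → sum (λ v → sum (λ w → 𝟙△ u z w * (e z v * e w v))))
        ≡⟨ sum-cong-≗ (λ z → ∑-comm (λ v w → 𝟙△ u z w * (e z v * e w v))) ⟩
      sum (λ z → sum (λ w → sum (λ v → 𝟙△ u z w * (e z v * e w v))))
        ≡⟨ sum-cong-≗ (λ z → sum-cong-≗ (λ w → *-distribˡ-sum (𝟙△ u z w) (λ v → e z v * e w v))) ⟨
      sum (λ z → sum (λ w → 𝟙△ u z w * codeg z w))
        ∎
      where
      open ≡-Reasoning
      regroup : ∀ a b c d f → a * b * (c * d * f) ≡ a * c * d * (b * f)
      regroup = solve-∀
      expand : ∀ v z → e u z * e v z * codeg₃ z u v ≡ sum (λ w → 𝟙△ u z w * (e z v * e w v))
      expand v z = trans (*-distribˡ-sum (e u z * e v z) (λ w → e z w * e u w * e v w))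
        (sum-cong-≗ (λ w → trans
          (cong₂ (λ p q → e u z * p * (e z w * e u w * q)) (e-sym v z) (e-sym v w))
          (regroup (e u z) (e z v) (e z w) (e u w) (e w v))))

    adj⇒≢ : ∀ {x y} → adj G x y ≡ true → x ≢ y
    adj⇒≢ {x} x~x refl with trans (sym (adj-irrefl G x)) x~x
    ... | ()

    clique-∪⁅⁆ : ∀ {T y} → IsClique G T → (∀ x → x ∈ T → adj G y x ≡ true) → IsClique G (T ∪ ⁅ y ⁆)
    clique-∪⁅⁆ {T} {y} T-clique y~T x x′ x∈ x′∈ x≢x′ with x∈p∪q⁻ T ⁅ y ⁆ x∈ | x∈p∪q⁻ T ⁅ y ⁆ x′∈
    ... | inj₁ x∈T | inj₁ x′∈T = T-clique x x′ x∈T x′∈T x≢x′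
    ... | inj₁ x∈T | inj₂ x′∈y rewrite x∈⁅y⁆⇒x≡y y x′∈y = trans (adj-sym G x y) (y~T x x∈T)
    ... | inj₂ x∈y | inj₁ x′∈T rewrite x∈⁅y⁆⇒x≡y y x∈y = y~T x′ x′∈T
    ... | inj₂ x∈y | inj₂ x′∈y = contradiction (trans (x∈⁅y⁆⇒x≡y y x∈y) (sym (x∈⁅y⁆⇒x≡y y x′∈y))) x≢x′

    clique⇒KFactor : ∀ {r S} → IsClique G S → ∣ S ∣ ≡ r → HasKFactor G r S
    clique⇒KFactor {S = S} S-clique ∣S∣≡r =
      S ∷ [] , ((λ x∈S → x∈S) , ∣S∣≡r , S-clique) ∷ [] , [] ∷ [] , λ _ x∈S → Any.here x∈S

    clique? : ∀ T → Dec (IsClique G T)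
    clique? T = all? λ x → all? λ y → x ∈? T →-dec y ∈? T →-dec ¬? (x Fin.≟ y) →-dec adj G x y Bool.≟ true

    containsK? : ∀ ℓ S → Dec (ContainsK G ℓ S)
    containsK? ℓ S = anySubset? λ T → T ⊆? S ×-dec ∣ T ∣ ℕ.≟ ℓ ×-dec clique? T

    -- InnerReachable G r c t U u v unfolds to: for every small W, Connector r t U W u v
    Connector : ℕ → ℕ → Subset n → Subset n → Fin n → Fin n → Set
    Connector r t U W u v = Σ (Subset n) λ S →
      S ⊆ U × (∀ x → x ∈ S → x ∉ W) × ∣ S ∣ ≤ r * t ∸ 1 × HasKFactor G r (S ∪ ⁅ u ⁆) × HasKFactor G r (S ∪ ⁅ v ⁆)

    common-clique⇒connector : ∀ {r U W u v S} → IsClique G S → suc ∣ S ∣ ≡ r → S ⊆ U →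
      (∀ x → x ∈ S → adj G u x ≡ true × adj G v x ≡ true × x ∉ W) → Connector r 1 U W u v
    common-clique⇒connector {u = u} {v} {S} S-clique refl S⊆U common =
      S , S⊆U , (λ x x∈S → proj₂ (proj₂ (common x x∈S))) , ≤-reflexive (sym (ℕ.*-identityʳ ∣ S ∣)) ,
      extend u (λ x x∈S → proj₁ (common x x∈S)) , extend v (λ x x∈S → proj₁ (proj₂ (common x x∈S)))
      where
      extend : ∀ y → (∀ x → x ∈ S → adj G y x ≡ true) → HasKFactor G (suc ∣ S ∣) (S ∪ ⁅ y ⁆)
      extend y y~S = clique⇒KFactor (clique-∪⁅⁆ S-clique y~S)
        (x∉p⇒∣p∪⁅x⁆∣≡1+∣p∣ S y (λ y∈S → adj⇒≢ (y~S y y∈S) refl))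

    N₃∖ : Subset n → Fin n → Fin n → Fin n → Subset n
    N₃∖ W x y z = tabulate (λ w → adj G x w ∧ adj G y w ∧ adj G z w ∧ not (lookup W w))

    ∈N₃∖⁻ : ∀ W x y z {w} → w ∈ N₃∖ W x y z →
            adj G x w ≡ true × adj G y w ≡ true × adj G z w ≡ true × w ∉ W
    ∈N₃∖⁻ W x y z w∈ =
      let (x~w , rest₁) = ∧-split (∈-tabulate⁻ w∈)
          (y~w , rest₂) = ∧-split rest₁
          (z~w , w∉W)   = ∧-split rest₂
      in x~w , y~w , z~w , not-lookup⇒∉ w∉W
      where
      ∧-split : ∀ {a b} → a ∧ b ≡ true → a ≡ true × b ≡ true
      ∧-split a∧b = ∧-conicalˡ _ _ a∧b , ∧-conicalʳ _ _ a∧b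

    codeg₃≤∣N₃∖∣+∣W∣ : ∀ W x y z → codeg₃ x y z ≤ ∣ N₃∖ W x y z ∣ + ∣ W ∣
    codeg₃≤∣N₃∖∣+∣W∣ W x y z = begin
      codeg₃ x y z
        ≤⟨ sum-mono-≤ (λ w → split (adj G x w) (adj G y w) (adj G z w) (lookup W w)) ⟩
      sum (λ w → 𝟙 (adj G x w ∧ adj G y w ∧ adj G z w ∧ not (lookup W w)) + 𝟙 (lookup W w))
        ≡⟨ ∑-distrib-+ (λ w → 𝟙 (adj G x w ∧ adj G y w ∧ adj G z w ∧ not (lookup W w))) (𝟙 ∘ lookup W) ⟩
      sum (λ w → 𝟙 (adj G x w ∧ adj G y w ∧ adj G z w ∧ not (lookup W w))) + sum (𝟙 ∘ lookup W)
        ≡⟨ cong₂ _+_ (sym (∣tabulate∣≡∑𝟙 (λ w → adj G x w ∧ adj G y w ∧ adj G z w ∧ not (lookup W w))))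
                     (sym (∣p∣≡∑𝟙 W)) ⟩
      ∣ N₃∖ W x y z ∣ + ∣ W ∣
        ∎
      where
      open ≤-Reasoning
      split : ∀ a b c d → 𝟙 a * 𝟙 b * 𝟙 c ≤ 𝟙 (a ∧ b ∧ c ∧ not d) + 𝟙 d
      split a    b     c     true  = ≤-trans (𝟙*𝟙*𝟙≤1 a b c) (m≤n+m 1 _)
      split true true  true  false = ≤-refl
      split true true  false false = z≤n
      split true false c     false = z≤n
      split false b    c     false = z≤n

    module _ (c : ℕ) (W : Subset n) (u v : Fin n) where

      Hub : Fin n → Set
      Hub z = adj G u z ≡ true × adj G v z ≡ true × z ∉ W × n < c * ∣ N₃∖ W z u v ∣

      hub? : ∀ z → Dec (Hub z)
      hub? z = adj G u z Bool.≟ true ×-dec adj G v z Bool.≟ true ×-dec ¬? (z ∈? W)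
               ×-dec n <? c * ∣ N₃∖ W z u v ∣

      no-hub⇒c*edges∩≤3n² : c * ∣ W ∣ ≤ n → (∀ z → ¬ Hub z) → c * edges∩ u v ≤ 3 * n * n
      no-hub⇒c*edges∩≤3n² c∣W∣≤n no-hub = begin
        c * edges∩ u v                                   ≡⟨ *-distribˡ-sum c (λ z → e u z * e v z * codeg₃ z u v) ⟩
        sum (λ z → c * (e u z * e v z * codeg₃ z u v))   ≤⟨ sum-mono-≤ term≤ ⟩
        sum (λ z → c * n * 𝟙 (lookup W z) + 2 * n)       ≡⟨ ∑-distrib-+ (λ z → c * n * 𝟙 (lookup W z)) (λ _ → 2 * n) ⟩
        sum (λ z → c * n * 𝟙 (lookup W z)) + sum {n} (λ _ → 2 * n)
          ≡⟨ cong₂ _+_ (sym (*-distribˡ-sum (c * n) (𝟙 ∘ lookup W))) (sum-const n (2 * n)) ⟩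
        c * n * sum (𝟙 ∘ lookup W) + n * (2 * n)         ≡⟨ cong (λ m → c * n * m + n * (2 * n)) (sym (∣p∣≡∑𝟙 W)) ⟩
        c * n * ∣ W ∣ + n * (2 * n)                      ≡⟨ regroup₁ c n ∣ W ∣ ⟩
        n * (c * ∣ W ∣) + 2 * n * n                      ≤⟨ ℕ.+-monoˡ-≤ (2 * n * n) (*-monoʳ-≤ n c∣W∣≤n) ⟩
        n * n + 2 * n * n                                ≡⟨ regroup₂ n ⟩
        3 * n * n                                        ∎
        where
        open ≤-Reasoning
        regroup₁ : ∀ a m w → a * m * w + m * (2 * m) ≡ m * (a * w) + 2 * m * m
        regroup₁ = solve-∀
        regroup₂ : ∀ m → m * m + 2 * m * m ≡ 3 * m * m
        regroup₂ = solve-∀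
        term≤ : ∀ z → c * (e u z * e v z * codeg₃ z u v) ≤ c * n * 𝟙 (lookup W z) + 2 * n
        term≤ z with adj G u z in u~z | adj G v z in v~z | lookup W z in z∈W
        ... | a     | b     | true  = ≤-trans (*-monoʳ-≤ c (≤-trans (𝟙*𝟙*≤ a b (codeg₃ z u v)) (codeg₃≤n z u v)))
                                              (≤-trans (≤-reflexive (sym (ℕ.*-identityʳ (c * n)))) (m≤m+n _ _))
        ... | false | _     | false = ≤-trans (≤-reflexive (ℕ.*-zeroʳ c)) z≤n
        ... | true  | false | false = ≤-trans (≤-reflexive (ℕ.*-zeroʳ c)) z≤n
        ... | true  | true  | false = begin
          c * (1 * 1 * codeg₃ z u v)               ≡⟨ cong (c *_) (ℕ.*-identityˡ (codeg₃ z u v)) ⟩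
          c * codeg₃ z u v                         ≤⟨ *-monoʳ-≤ c (codeg₃≤∣N₃∖∣+∣W∣ W z u v) ⟩
          c * (∣ N₃∖ W z u v ∣ + ∣ W ∣)            ≡⟨ ℕ.*-distribˡ-+ c ∣ N₃∖ W z u v ∣ ∣ W ∣ ⟩
          c * ∣ N₃∖ W z u v ∣ + c * ∣ W ∣          ≤⟨ +-mono-≤ (≮⇒≥ (λ dense → no-hub z (u~z , v~z , z∉W , dense))) c∣W∣≤n ⟩
          n + n                                    ≤⟨ m≤n+m (n + n) (c * n * 0) ⟩
          c * n * 0 + (n + n)                      ≡⟨ cong (λ m → c * n * 0 + (n + m)) (sym (ℕ.+-identityʳ n)) ⟩
          c * n * 0 + 2 * n                        ∎
          where z∉W = not-lookup⇒∉ (cong not z∈W)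

      hub-exists : c * ∣ W ∣ ≤ n → 3 * n * n < c * edges∩ u v → ∃ Hub
      hub-exists c∣W∣≤n dense = decidable-stable (any? hub?)
        (λ ¬∃hub → <⇒≱ dense (no-hub⇒c*edges∩≤3n² c∣W∣≤n (λ z hub → ¬∃hub (z , hub))))

      hub⇒common-clique : ∀ {z} ℓ → (∀ S → n < c * ∣ S ∣ → ContainsK G ℓ S) → Hub z →
        Σ (Subset n) λ S → IsClique G S × ∣ S ∣ ≡ suc ℓ ×
          (∀ x → x ∈ S → adj G u x ≡ true × adj G v x ≡ true × x ∉ W)
      hub⇒common-clique {z} ℓ dense⇒Kℓ (u~z , v~z , z∉W , dense) with dense⇒Kℓ (N₃∖ W z u v) dense
      ... | K , K⊆N₃∖ , ∣K∣≡ℓ , K-clique =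
        K ∪ ⁅ z ⁆ , clique-∪⁅⁆ K-clique (λ x x∈K → proj₁ (in-N₃∖ x∈K)) ,
        trans (x∉p⇒∣p∪⁅x⁆∣≡1+∣p∣ K z z∉K) (cong suc ∣K∣≡ℓ) , common
        where
        in-N₃∖ : ∀ {x} → x ∈ K → adj G z x ≡ true × adj G u x ≡ true × adj G v x ≡ true × x ∉ W
        in-N₃∖ x∈K = ∈N₃∖⁻ W z u v (K⊆N₃∖ x∈K)
        z∉K : z ∉ K
        z∉K z∈K = adj⇒≢ (proj₁ (in-N₃∖ z∈K)) refl
        common : ∀ x → x ∈ K ∪ ⁅ z ⁆ → adj G u x ≡ true × adj G v x ≡ true × x ∉ W
        common x x∈ with x∈p∪q⁻ K ⁅ z ⁆ x∈
        ... | inj₁ x∈K = proj₂ (in-N₃∖ x∈K)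
        ... | inj₂ x∈z rewrite x∈⁅y⁆⇒x≡y z x∈z = u~z , v~z , z∉W

    module _ (k : ℕ) .{{_ : NonZero k}} (deg-bound : ∀ v → (k + 1) * n ≤ 2 * k * deg G v) where

      n≤2*deg : ∀ v → n ≤ 2 * deg G v
      n≤2*deg v = ℕ.*-cancelˡ-≤ k (begin
        k * n              ≤⟨ ℕ.*-monoˡ-≤ n (m≤m+n k 1) ⟩
        (k + 1) * n        ≤⟨ deg-bound v ⟩
        2 * k * deg G v    ≡⟨ reassoc k (deg G v) ⟩
        k * (2 * deg G v)  ∎)
        where
        open ≤-Reasoning
        reassoc : ∀ b d → 2 * b * d ≡ b * (2 * d)
        reassoc = solve-∀

      n≤k*codeg : ∀ x y → n ≤ k * codeg x y
      n≤k*codeg x y = ℕ.*-cancelˡ-≤ 2 (ℕ.+-cancelˡ-≤ (2 * k * n) _ _ (begin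
        2 * k * n + 2 * n                  ≡⟨ split k n ⟩
        (k + 1) * n + (k + 1) * n          ≤⟨ +-mono-≤ (deg-bound x) (deg-bound y) ⟩
        2 * k * deg G x + 2 * k * deg G y  ≡⟨ ℕ.*-distribˡ-+ (2 * k) (deg G x) (deg G y) ⟨
        2 * k * (deg G x + deg G y)        ≤⟨ *-monoʳ-≤ (2 * k) (deg+deg≤n+codeg x y) ⟩
        2 * k * (n + codeg x y)            ≡⟨ expand k n (codeg x y) ⟩
        2 * k * n + 2 * (k * codeg x y)    ∎))
        where
        open ≤-Reasoning
        split : ∀ b m → 2 * b * m + 2 * m ≡ (b + 1) * m + (b + 1) * m
        split = solve-∀
        expand : ∀ b m c → 2 * b * (m + c) ≡ 2 * b * m + 2 * (b * c)
        expand = solve-∀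

      n*deg≤k*∑e*codeg : ∀ u → n * deg G u ≤ k * sum (λ z → e u z * codeg z u)
      n*deg≤k*∑e*codeg u = begin
        n * deg G u                        ≡⟨ cong (n *_) (deg≡∑e u) ⟩
        n * sum (e u)                      ≤⟨ sum-weighted-≥ n k (e u) (λ z → codeg z u) (λ z → n≤k*codeg z u) ⟩
        k * sum (λ z → e u z * codeg z u)  ∎
        where open ≤-Reasoning

      n*∑e*codeg≤k*∑edges∩ : ∀ u → n * sum (λ z → e u z * codeg z u) ≤ k * sum (edges∩ u)
      n*∑e*codeg≤k*∑edges∩ u = begin
        n * sum (λ z → e u z * codeg z u)                  ≡⟨ cong (n *_) (sum-cong-≗ ∑𝟙△≡) ⟨
        n * sum (λ z → sum (𝟙△ u z))                       ≡⟨ *-distribˡ-sum n (λ z → sum (𝟙△ u z)) ⟩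
        sum (λ z → n * sum (𝟙△ u z))                       ≤⟨ sum-mono-≤ (λ z → sum-weighted-≥ n k (𝟙△ u z) (codeg z) (n≤k*codeg z)) ⟩
        sum (λ z → k * sum (λ w → 𝟙△ u z w * codeg z w))   ≡⟨ *-distribˡ-sum k (λ z → sum (λ w → 𝟙△ u z w * codeg z w)) ⟨
        k * sum (λ z → sum (λ w → 𝟙△ u z w * codeg z w))   ≡⟨ cong (k *_) (∑edges∩≡ u) ⟨
        k * sum (edges∩ u)                                 ∎
        where
        open ≤-Reasoning
        ∑𝟙△≡ : ∀ z → sum (𝟙△ u z) ≡ e u z * codeg z u
        ∑𝟙△≡ z = trans (sum-cong-≗ (λ w → ℕ.*-assoc (e u z) (e z w) (e u w)))
                       (sym (*-distribˡ-sum (e u z) (λ w → e z w * e u w)))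

      n³≤2k²∑edges∩ : ∀ u → n * n * n ≤ 2 * (k * k) * sum (edges∩ u)
      n³≤2k²∑edges∩ u = begin
        n * n * n                                       ≤⟨ *-monoʳ-≤ (n * n) (n≤2*deg u) ⟩
        n * n * (2 * deg G u)                           ≡⟨ regroup₁ n (deg G u) ⟩
        2 * n * (n * deg G u)                           ≤⟨ *-monoʳ-≤ (2 * n) (n*deg≤k*∑e*codeg u) ⟩
        2 * n * (k * sum (λ z → e u z * codeg z u))     ≡⟨ regroup₂ n k (sum (λ z → e u z * codeg z u)) ⟩
        2 * k * (n * sum (λ z → e u z * codeg z u))     ≤⟨ *-monoʳ-≤ (2 * k) (n*∑e*codeg≤k*∑edges∩ u) ⟩
        2 * k * (k * sum (edges∩ u))                    ≡⟨ regroup₃ k (sum (edges∩ u)) ⟩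
        2 * (k * k) * sum (edges∩ u)                    ∎
        where
        open ≤-Reasoning
        regroup₁ : ∀ m d → m * m * (2 * d) ≡ 2 * m * (m * d)
        regroup₁ = solve-∀
        regroup₂ : ∀ m b s → 2 * m * (b * s) ≡ 2 * b * (m * s)
        regroup₂ = solve-∀
        regroup₃ : ∀ b s → 2 * b * (b * s) ≡ 2 * (b * b) * s
        regroup₃ = solve-∀

      good : Fin n → Subset n
      good u = above (3 * n * n) (λ v → 16 * (k * k) * edges∩ u v)

      5n≤16k²∣good∣ : ∀ u → .{{NonZero n}} → 5 * n ≤ 16 * (k * k) * ∣ good u ∣
      5n≤16k²∣good∣ u = ℕ.*-cancelʳ-≤ (5 * n) _ (n * n) {{ℕ.m*n≢0 n n}} (ℕ.+-cancelʳ-≤ (3 * n * n * n) _ _ (begin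
        5 * n * (n * n) + 3 * n * n * n                    ≡⟨ regroup₁ n ⟩
        8 * (n * n * n)                                    ≤⟨ *-monoʳ-≤ 8 (n³≤2k²∑edges∩ u) ⟩
        8 * (2 * (k * k) * sum (edges∩ u))                 ≡⟨ regroup₂ k (sum (edges∩ u)) ⟩
        16 * (k * k) * sum (edges∩ u)                      ≡⟨ *-distribˡ-sum (16 * (k * k)) (edges∩ u) ⟩
        sum (λ v → 16 * (k * k) * edges∩ u v)              ≤⟨ sum≤bound*∣above∣+n*t _ (16 * (k * k) * (n * n)) (3 * n * n)
                                                                (λ v → *-monoʳ-≤ (16 * (k * k)) (edges∩≤n*n u v)) ⟩
        16 * (k * k) * (n * n) * ∣ good u ∣ + n * (3 * n * n) ≡⟨ regroup₃ k n ∣ good u ∣ ⟩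
        16 * (k * k) * ∣ good u ∣ * (n * n) + 3 * n * n * n   ∎))
        where
        open ≤-Reasoning
        regroup₁ : ∀ m → 5 * m * (m * m) + 3 * m * m * m ≡ 8 * (m * m * m)
        regroup₁ = solve-∀
        regroup₂ : ∀ b s → 8 * (2 * (b * b) * s) ≡ 16 * (b * b) * s
        regroup₂ = solve-∀
        regroup₃ : ∀ b m g → 16 * (b * b) * (m * m) * g + m * (3 * m * m) ≡ 16 * (b * b) * g * (m * m) + 3 * m * m * m
        regroup₃ = solve-∀

      n≤4k²∣good-u∣ : ∀ u → .{{NonZero n}} → 16 * (k * k) ≤ n → n ≤ 4 * (k * k) * ∣ good u - u ∣
      n≤4k²∣good-u∣ u 16k²≤n = ℕ.*-cancelˡ-≤ 4 (ℕ.+-cancelʳ-≤ n _ _ (begin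
        4 * n + n                                        ≡⟨ regroup₁ n ⟩
        5 * n                                            ≤⟨ 5n≤16k²∣good∣ u ⟩
        16 * (k * k) * ∣ good u ∣                        ≤⟨ *-monoʳ-≤ (16 * (k * k)) (∣p∣≤1+∣p-x∣ (good u) u) ⟩
        16 * (k * k) * suc ∣ good u - u ∣                ≡⟨ regroup₂ k ∣ good u - u ∣ ⟩
        4 * (4 * (k * k) * ∣ good u - u ∣) + 16 * (k * k) ≤⟨ ℕ.+-monoʳ-≤ _ 16k²≤n ⟩
        4 * (4 * (k * k) * ∣ good u - u ∣) + n            ∎))
        where
        open ≤-Reasoning
        regroup₁ : ∀ m → 4 * m + m ≡ 5 * m
        regroup₁ = solve-∀
        regroup₂ : ∀ b r → 16 * (b * b) * suc r ≡ 4 * (4 * (b * b) * r) + 16 * (b * b)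
        regroup₂ = solve-∀

      good⇒connector : ∀ ℓ → (∀ S → n < 16 * (k * k) * ∣ S ∣ → ContainsK G ℓ S) →
        ∀ u v → v ∈ good u → ∀ W → 16 * (k * k) * ∣ W ∣ ≤ n → Connector (suc (suc ℓ)) 1 ⊤ W u v
      good⇒connector ℓ dense⇒Kℓ u v v∈good W small =
        let (z , z-hub) = hub-exists (16 * (k * k)) W u v small (∈-above⁻ {f = λ v → 16 * (k * k) * edges∩ u v} v∈good)
            (S , S-clique , ∣S∣≡1+ℓ , common) = hub⇒common-clique (16 * (k * k)) W u v ℓ dense⇒Kℓ z-hub
        in common-clique⇒connector S-clique (cong suc ∣S∣≡1+ℓ) (λ _ → ∈⊤) common

module RationalBounds where

  open import Data.Integer as ℤ using (+_; -[1+_])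
  import Data.Integer.Properties as ℤ
  open import Data.Nat as ℕ using (ℕ; suc; _+_; _*_; _≤_; z≤n; s≤s; NonZero)
  open import Data.Nat.Properties as ℕ using (≤-trans; ≤-reflexive; *-monoʳ-≤; module ≤-Reasoning)
  open import Data.Product using (Σ; _,_)
  open import Data.Rational as ℚ using (ℚ; mkℚ; toℚᵘ; 0ℚ; ½; _/_)
  import Data.Rational.Properties as ℚ
  open import Data.Rational.Unnormalised as ℚᵘ using (mkℚᵘ; *≤*; *<*; *≡*)
  import Data.Rational.Unnormalised.Properties as ℚᵘ
  open import Relation.Binary.PropositionalEquality

  -- mkℚᵘ (+ a) b denotes a / (1 + b); comparisons of such fractions cross-multiply in ℕ.
  toℚᵘ-ℕ→ℚ : ∀ x → toℚᵘ (ℕ→ℚ x) ℚᵘ.≃ mkℚᵘ (+ x) 0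
  toℚᵘ-ℕ→ℚ x = ℚ.toℚᵘ-fromℚᵘ (mkℚᵘ (+ x) 0)

  toℚᵘ-*ℕ→ℚ : ∀ {q a b} x → toℚᵘ q ℚᵘ.≃ mkℚᵘ (+ a) b → toℚᵘ (q ℚ.* ℕ→ℚ x) ℚᵘ.≃ mkℚᵘ (+ (a * x)) b
  toℚᵘ-*ℕ→ℚ {q} {a} {b} x q≃a/b = ℚᵘ.≃-trans (ℚ.toℚᵘ-homo-* q (ℕ→ℚ x))
    (ℚᵘ.≃-trans (ℚᵘ.*-cong q≃a/b (toℚᵘ-ℕ→ℚ x))
      (*≡* (cong₂ ℤ._*_ (sym (ℤ.pos-* a x)) (cong (λ d → + suc d) (sym (ℕ.*-identityʳ b))))))

  ≤ᵘ⇒ : ∀ {a b c d} → mkℚᵘ (+ a) b ℚᵘ.≤ mkℚᵘ (+ c) d → a * suc d ≤ c * suc b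
  ≤ᵘ⇒ {a} {b} {c} {d} (*≤* ad≤cb) =
    ℤ.drop‿+≤+ (subst₂ ℤ._≤_ (sym (ℤ.pos-* a (suc d))) (sym (ℤ.pos-* c (suc b))) ad≤cb)

  ≤ᵘ⇐ : ∀ {a b c d} → a * suc d ≤ c * suc b → mkℚᵘ (+ a) b ℚᵘ.≤ mkℚᵘ (+ c) d
  ≤ᵘ⇐ {a} {b} {c} {d} ad≤cb = *≤* (subst₂ ℤ._≤_ (ℤ.pos-* a (suc d)) (ℤ.pos-* c (suc b)) (ℤ.+≤+ ad≤cb))

  module _ {q a b} (q≃a/b : toℚᵘ q ℚᵘ.≃ mkℚᵘ (+ a) b) where

    *ℕ≤ℕ⇒ : ∀ x y → q ℚ.* ℕ→ℚ x ℚ.≤ ℕ→ℚ y → a * x ≤ suc b * y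
    *ℕ≤ℕ⇒ x y qx≤y = subst₂ _≤_ (ℕ.*-identityʳ (a * x)) (ℕ.*-comm y (suc b))
      (≤ᵘ⇒ (ℚᵘ.≤-respˡ-≃ (toℚᵘ-*ℕ→ℚ x q≃a/b) (ℚᵘ.≤-respʳ-≃ (toℚᵘ-ℕ→ℚ y) (ℚ.toℚᵘ-mono-≤ qx≤y))))

    *ℕ≤ℕ⇐ : ∀ x y → a * x ≤ suc b * y → q ℚ.* ℕ→ℚ x ℚ.≤ ℕ→ℚ y
    *ℕ≤ℕ⇐ x y ax≤by = ℚ.toℚᵘ-cancel-≤
      (ℚᵘ.≤-respˡ-≃ (ℚᵘ.≃-sym (toℚᵘ-*ℕ→ℚ x q≃a/b)) (ℚᵘ.≤-respʳ-≃ (ℚᵘ.≃-sym (toℚᵘ-ℕ→ℚ y))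
        (≤ᵘ⇐ (subst₂ _≤_ (sym (ℕ.*-identityʳ (a * x))) (ℕ.*-comm (suc b) y) ax≤by))))

    ℕ≤*ℕ⇒ : ∀ x y → ℕ→ℚ y ℚ.≤ q ℚ.* ℕ→ℚ x → suc b * y ≤ a * x
    ℕ≤*ℕ⇒ x y y≤qx = subst₂ _≤_ (ℕ.*-comm y (suc b)) (ℕ.*-identityʳ (a * x))
      (≤ᵘ⇒ (ℚᵘ.≤-respʳ-≃ (toℚᵘ-*ℕ→ℚ x q≃a/b) (ℚᵘ.≤-respˡ-≃ (toℚᵘ-ℕ→ℚ y) (ℚ.toℚᵘ-mono-≤ y≤qx))))

    ℕ≤*ℕ⇐ : ∀ x y → suc b * y ≤ a * x → ℕ→ℚ y ℚ.≤ q ℚ.* ℕ→ℚ x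
    ℕ≤*ℕ⇐ x y by≤ax = ℚ.toℚᵘ-cancel-≤
      (ℚᵘ.≤-respʳ-≃ (ℚᵘ.≃-sym (toℚᵘ-*ℕ→ℚ x q≃a/b)) (ℚᵘ.≤-respˡ-≃ (ℚᵘ.≃-sym (toℚᵘ-ℕ→ℚ y))
        (≤ᵘ⇐ (subst₂ _≤_ (ℕ.*-comm (suc b) y) (sym (ℕ.*-identityʳ (a * x))) by≤ax))))

  toℚᵘ-1/ : ∀ m → toℚᵘ (+ 1 / suc m) ℚᵘ.≃ mkℚᵘ (+ 1) m
  toℚᵘ-1/ m = ℚ.toℚᵘ-fromℚᵘ (mkℚᵘ (+ 1) m)

  0<1/ : ∀ m .{{_ : NonZero m}} → 0ℚ ℚ.< + 1 / m
  0<1/ (suc m) = ℚ.toℚᵘ-cancel-< (ℚᵘ.<-respʳ-≃ (ℚᵘ.≃-sym (toℚᵘ-1/ m)) (*<* (ℤ.+<+ (s≤s z≤n))))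

  1/m*ℕ≤ℕ⇐ : ∀ m .{{_ : NonZero m}} x y → x ≤ m * y → + 1 / m ℚ.* ℕ→ℚ x ℚ.≤ ℕ→ℚ y
  1/m*ℕ≤ℕ⇐ (suc m) x y x≤my = *ℕ≤ℕ⇐ (toℚᵘ-1/ m) x y (≤-trans (≤-reflexive (ℕ.+-identityʳ x)) x≤my)

  ℕ≤1/m*ℕ⇒ : ∀ m .{{_ : NonZero m}} x y → ℕ→ℚ y ℚ.≤ + 1 / m ℚ.* ℕ→ℚ x → m * y ≤ x
  ℕ≤1/m*ℕ⇒ (suc m) x y y≤x/m = ≤-trans (ℕ≤*ℕ⇒ (toℚᵘ-1/ m) x y y≤x/m) (≤-reflexive (ℕ.+-identityʳ x))

  0≤*ℕ→ℚ : ∀ q → 0ℚ ℚ.< q → ∀ x → ℕ→ℚ 0 ℚ.≤ q ℚ.* ℕ→ℚ x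
  0≤*ℕ→ℚ (mkℚ (+ a) b _)    _           x = ℕ≤*ℕ⇐ ℚᵘ.≃-refl x 0 (≤-trans (≤-reflexive (ℕ.*-zeroʳ (suc b))) z≤n)
  0≤*ℕ→ℚ (mkℚ -[1+ a ] b _) (ℚ.*<* ())

  ½<½+ : ∀ q → 0ℚ ℚ.< q → ½ ℚ.< ½ ℚ.+ q
  ½<½+ q 0<q = subst (ℚ._< ½ ℚ.+ q) (ℚ.+-identityʳ ½) (ℚ.+-monoʳ-< ½ 0<q)

  ½<⇒[1+k]/2k≤ : ∀ q → ½ ℚ.< q → Σ ℕ λ b → ∀ x y → q ℚ.* ℕ→ℚ x ℚ.≤ ℕ→ℚ y → (suc b + 1) * x ≤ 2 * suc b * y
  ½<⇒[1+k]/2k≤ (mkℚ (+ a) b _) (ℚ.*<* ½<q) = b , λ x y qx≤y → begin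
    (suc b + 1) * x  ≤⟨ ℕ.*-monoˡ-≤ x 1+k≤2a ⟩
    a * 2 * x        ≡⟨ regroup a x ⟩
    2 * (a * x)      ≤⟨ *-monoʳ-≤ 2 (*ℕ≤ℕ⇒ ℚᵘ.≃-refl x y qx≤y) ⟩
    2 * (suc b * y)  ≡⟨ ℕ.*-assoc 2 (suc b) y ⟨
    2 * suc b * y    ∎
    where
    open ≤-Reasoning
    regroup : ∀ a x → a * 2 * x ≡ 2 * (a * x)
    regroup a x = trans (cong (_* x) (ℕ.*-comm a 2)) (ℕ.*-assoc 2 a x)
    1+k≤2a : suc b + 1 ≤ a * 2
    1+k≤2a = ≤-trans (≤-reflexive (ℕ.+-comm (suc b) 1))
      (subst (λ m → suc m ≤ a * 2) (ℕ.*-identityˡ (suc b))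
        (ℤ.drop‿+<+ (subst₂ ℤ._<_ (sym (ℤ.pos-* 1 (suc b))) (sym (ℤ.pos-* a 2)) ½<q)))
  ½<⇒[1+k]/2k≤ (mkℚ -[1+ a ] b _) (ℚ.*<* ())

open import Data.Nat using (ℕ; _≥_; _∸_)
open import Data.Rational using (ℚ; _<_; _≤_; _*_; _+_; 0ℚ; ½)
open import Data.Fin using (Fin)
open import Data.Fin.Subset using (Subset; _∈_; _∉_; _⊆_; ∣_∣; ⊤; ⊥; _-_)
open import Data.Fin.Subset.Properties using (∈⊤; ∉⊥; ∣⊥∣≡0; p─q⊆p)
open import Data.Integer using (+_)
import Data.Nat as ℕ
import Data.Nat.Properties as ℕ
import Data.Rational as ℚ
import Data.Rational.Properties as ℚ
open import Data.Product using (Σ; _×_; _,_)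
open import Data.Sum using (_⊎_; inj₂)
open import Relation.Binary.PropositionalEquality using (subst; sym)
open import Relation.Nullary using (¬_)
open import Relation.Nullary.Decidable using (decidable-stable)
open Combinatorics
open RationalBounds

lemma5p6 : (r : ℕ) → r ≥ 4 → (τ μ : ℚ) → 0ℚ < τ → τ < μ →
    Σ ℚ λ α → Σ ℚ λ β₁ → Σ ℚ λ γ₁ → 0ℚ < α × 0ℚ < β₁ × 0ℚ < γ₁ ×
    Σ ℕ λ n₀ → ∀ (n : ℕ) → n ≥ n₀ → (G : Graph n) →
      MinDegAtLeast G (½ + μ) → AlphaAtMost G (r ∸ 2) α →
      Σ (Subset n) λ B → Σ (Subset n) λ U →
        (∀ x → (x ∈ B ⊎ x ∈ U) × ¬ (x ∈ B × x ∈ U)) ×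
        ℕ→ℚ ∣ B ∣ ≤ τ * ℕ→ℚ n ×
        (∀ u → u ∈ U →
          Σ (Subset n) λ R → R ⊆ U × u ∉ R × γ₁ * ℕ→ℚ n ≤ ℕ→ℚ ∣ R ∣ ×
            (∀ v → v ∈ R → InnerReachable G r β₁ 1 U u v))
-- only r ≥ 2 is used
lemma5p6 (ℕ.suc (ℕ.suc ℓ)) (ℕ.s≤s (ℕ.s≤s _)) τ μ 0<τ τ<μ
  with b , scale ← ½<⇒[1+k]/2k≤ (½ + μ) (½<½+ μ (ℚ.<-trans 0<τ τ<μ)) =
  α , α , γ , 0<1/ M , 0<1/ M , 0<1/ (4 ℕ.* (k ℕ.* k)) , M , λ n M≤n G δG αG →
    let instance
          n≢0 : ℕ.NonZero n
          n≢0 = ℕ.>-nonZero (ℕ.<-≤-trans ℕ.z<s M≤n)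
        deg-bound : ∀ v → (k ℕ.+ 1) ℕ.* n ℕ.≤ 2 ℕ.* k ℕ.* deg G v
        deg-bound v = scale n (deg G v) (δG v)
        dense⇒Kℓ : ∀ S → n ℕ.< M ℕ.* ∣ S ∣ → ContainsK G ℓ S
        dense⇒Kℓ S n<M∣S∣ = decidable-stable (containsK? G ℓ S)
          (λ ¬K → ℕ.<⇒≱ n<M∣S∣ (ℕ≤1/m*ℕ⇒ M n ∣ S ∣ (αG S ¬K)))
        R : Fin n → Subset n
        R u = good G k deg-bound u - u
    in ⊥ , ⊤ , (λ x → inj₂ ∈⊤ , λ (x∈⊥ , _) → ∉⊥ x∈⊥) ,
       subst (λ m → ℕ→ℚ m ≤ τ * ℕ→ℚ n) (sym (∣⊥∣≡0 n)) (0≤*ℕ→ℚ τ 0<τ n) ,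
       λ u _ → R u , (λ _ → ∈⊤) , x∉p-x (good G k deg-bound u) u ,
         1/m*ℕ≤ℕ⇐ (4 ℕ.* (k ℕ.* k)) n ∣ R u ∣ (n≤4k²∣good-u∣ G k deg-bound u M≤n) ,
         λ v v∈R W ∣W∣≤βn → good⇒connector G k deg-bound ℓ dense⇒Kℓ u v (p─q⊆p _ _ v∈R) W
                               (ℕ≤1/m*ℕ⇒ M n ∣ W ∣ ∣W∣≤βn)
  where
  k M : ℕ
  k = ℕ.suc b
  M = 16 ℕ.* (k ℕ.* k)
  α γ : ℚ
  α = + 1 ℚ./ M
  γ = + 1 ℚ./ (4 ℕ.* (k ℕ.* k))
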